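{- For all integers $m\ge0$, the following identity of polynomials in $y$ holds: $$\begin{aligned}(1-yq^m)(1-y^2q^{ -2}abcd)F_m(bdy)={}&(1-y^2q^{m-2}abcd)(1-y)F_m(bdy/q)\\&-bdy(1-q^m)(1-q^{m-1})(1-abcdy^2q^{m-2})(1-abcdy^2q^{ -2})F_{m-2}(bdy)\\&+(1-q^m)\Big\{y\big[b+d+q^{ -1}bd(a+c)\big]-y^2\big[q^{ -1}(1+q^m)bd(a+c)+q^{ -2}(b+d)abcd\big]\\&\qquad+y^4\big[q^{m-3}ab^2cd^2(a+c)\big]\Big\}F_{m-1}(bdy).\end{aligned}$$
   Context: $a,b,c,d,q$ are indeterminates. The polynomials $F_m(y)$ are defined by $F_0(y)=1$, $F_m(y)=0$ for $m<0$, and for $m>0$: $F_m(y)=\big(b+d-y(a+c)q^{m-1}\big)F_{m-1}(y)+(q^{m-1}-1)\big(bd-acq^{m-2}y^2\big)F_{m-2}(y)$. $F_m(bdy)$ and $F_m(bdy/q)$ denote $F_m$ evaluated at $bdy$ and $bdy/q$. -}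

module Defs where

open import Level using (Level)
open import Algebra.Bundles using (CommutativeRing)
open import Data.Nat using (ℕ; zero; suc)
open import Data.Integer using (ℤ; +_; -[1+_])

module _ {ℓ₁ ℓ₂ : Level} (R : CommutativeRing ℓ₁ ℓ₂) where
  open CommutativeRing R

  pow : Carrier → ℕ → Carrier
  pow x zero    = 1#
  pow x (suc n) = x * pow x n

  -- integer powers of q, given a chosen inverse qi of q
  -- (the statement assumes q * qi ≈ 1#)
  zpow : Carrier → Carrier → ℤ → Carrier
  zpow q qi (+ n)      = pow q n
  zpow q qi -[1+ n ]   = pow qi (suc n)

  -- F_m(y), parameters a b c d q qi, defined by the paper's recurrence
  -- with F_0 = 1 and F_{-1} = 0
  F : (a b c d q qi : Carrier) → ℕ → Carrier → Carrier
  F a b c d q qi zero y = 1#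
  F a b c d q qi (suc zero) y =
      (b + d - y * (a + c) * zpow q qi (+ 0)) * 1#
    + (zpow q qi (+ 0) - 1#) * (b * d - a * c * zpow q qi -[1+ 0 ] * pow y 2) * 0#
  F a b c d q qi (suc (suc k)) y =
      (b + d - y * (a + c) * pow q (suc k)) * F a b c d q qi (suc k) y
    + (pow q (suc k) - 1#) * (b * d - a * c * pow q k * pow y 2) * F a b c d q qi k y

  Fz : (a b c d q qi : Carrier) → ℤ → Carrier → Carrier
  Fz a b c d q qi (+ n)    y = F a b c d q qi n y
  Fz a b c d q qi -[1+ n ] y = 0#

-- With e = abcd, G_m = F_m(bdv) and H_m = F_m(bdqv), the heart of the matter is the
-- q-difference relation
--   (1 - e q^m v²) G_m = (1 - e v²) H_m + (1 - q^m) (e (b+d) v² - bd (a+c) v) H_{m-1}.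
-- Using the recurrences of G and H, (1 - e q^{k+1} v²) times the defect of this relation at
-- k+2 is a combination of the defects at k+1 and k, so the relation follows by induction on m
-- once 1 - e q^{k+1} v² can be cancelled.  That is possible when v is an indeterminate: the
-- induction runs in R[X], and evaluation at X = y/q brings it back to R.  The proposition is
-- then a linear combination of the relation at v = y/q, the recurrence of F_m(bdy), and the
-- identities q⁻¹ q^j = q^{j-1}.

module Submission where

open import Defs
open import Level using (Level; _⊔_)
open import Algebra.Bundles using (CommutativeRing)
open import Algebra.Structures using (IsCommutativeRing)
open import Algebra.Morphism.Structures using (module RingMorphisms)
open import Algebra.Morphism.Construct.Identity using () renaming (isRingHomomorphism to id-isRingHomomorphism)
open import Algebra.Solver.Ring.AlmostCommutativeRing
  using (_-Raw-AlmostCommutative⟶_; fromCommutativeRing)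
open import Data.List using (List; []; _∷_; map)
open import Data.Maybe using (just; nothing)
open import Data.Nat as ℕ using (ℕ; zero; suc)
import Data.Nat.Properties as ℕₚ
open import Data.Integer using (+_; -[1+_]) renaming (_-_ to _-ℤ_)
open import Data.Integer as ℤ using (ℤ; _⊖_; +0; +[1+_])
import Data.Integer.Properties as ℤₚ
open import Data.Product using (_×_; _,_; proj₁; proj₂)
open import Data.Sign as Sign using (Sign)
open import Relation.Nullary.Decidable using (yes; no)
open import Relation.Binary.Bundles using (Setoid)
open import Relation.Binary.Definitions using (WeaklyDecidable)
open import Relation.Binary.PropositionalEquality as ≡ using (_≡_)
import Relation.Binary.Reasoning.Setoid as SetoidReasoning

-- Tactic.RingSolver does not recognise the operations of an abstract CommutativeRing, and with
-- the ring itself as coefficients the normal forms get stuck on coefficient arithmetic; so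
-- Algebra.Solver.Ring is instantiated with ℤ, interpreted by n ↦ n × 1#.
module IntegerCoefficientSolver {ℓ₁ ℓ₂ : Level} (R : CommutativeRing ℓ₁ ℓ₂) where
  open CommutativeRing R
  open import Algebra.Properties.Semiring.Mult.TCOptimised semiring using (×1-homo-*) renaming (_×_ to _×′_)
  open import Algebra.Properties.Monoid.Mult.TCOptimised +-monoid using (×-homo-+; 1+×)
  open import Algebra.Properties.Group +-group using (ε⁻¹≈ε; ⁻¹-involutive)
  open import Algebra.Properties.AbelianGroup +-abelianGroup using (⁻¹-∙-comm)
  open import Algebra.Properties.CommutativeSemigroup +-commutativeSemigroup using (interchange)
  open import Algebra.Properties.Ring ring using (-‿distribˡ-*; -‿distribʳ-*)
  open SetoidReasoning setoid

  ι : ℕ → Carrier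
  ι n = n ×′ 1#

  ⟦_⟧ℤ : ℤ → Carrier
  ⟦ + n      ⟧ℤ = ι n
  ⟦ -[1+ n ] ⟧ℤ = - ι (suc n)

  ⊖-homo : ∀ m n → ⟦ m ⊖ n ⟧ℤ ≈ ι m - ι n
  ⊖-homo zero    zero    = sym (trans (+-congˡ ε⁻¹≈ε) (+-identityʳ 0#))
  ⊖-homo zero    (suc n) = sym (+-identityˡ _)
  ⊖-homo (suc m) zero    = sym (trans (+-congˡ ε⁻¹≈ε) (+-identityʳ _))
  ⊖-homo (suc m) (suc n) = begin
    ⟦ suc m ⊖ suc n ⟧ℤ              ≡⟨ ≡.cong ⟦_⟧ℤ (ℤₚ.[1+m]⊖[1+n]≡m⊖n m n) ⟩
    ⟦ m ⊖ n ⟧ℤ                      ≈⟨ ⊖-homo m n ⟩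
    ι m - ι n                       ≈⟨ +-identityˡ _ ⟨
    0# + (ι m - ι n)                ≈⟨ +-congʳ (-‿inverseʳ 1#) ⟨
    (1# - 1#) + (ι m - ι n)         ≈⟨ interchange 1# (- 1#) (ι m) (- ι n) ⟩
    (1# + ι m) + (- 1# - ι n)       ≈⟨ +-congˡ (⁻¹-∙-comm 1# (ι n)) ⟩
    (1# + ι m) - (1# + ι n)         ≈⟨ +-cong (1+× m 1#) (-‿cong (1+× n 1#)) ⟨
    ι (suc m) - ι (suc n)           ∎

  +-homo : ∀ i j → ⟦ i ℤ.+ j ⟧ℤ ≈ ⟦ i ⟧ℤ + ⟦ j ⟧ℤ
  +-homo (+ m)      (+ n)      = ×-homo-+ 1# m n
  +-homo (+ m)      -[1+ n ]   = ⊖-homo m (suc n)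
  +-homo -[1+ m ]   (+ n)      = trans (⊖-homo n (suc m)) (+-comm _ _)
  +-homo -[1+ m ]   -[1+ n ]   = begin
    - ι (suc (suc (m ℕ.+ n)))       ≡⟨ ≡.cong (λ k → - ι (suc k)) (ℕₚ.+-suc m n) ⟨
    - ι (suc m ℕ.+ suc n)           ≈⟨ -‿cong (×-homo-+ 1# (suc m) (suc n)) ⟩
    - (ι (suc m) + ι (suc n))       ≈⟨ ⁻¹-∙-comm _ _ ⟨
    - ι (suc m) - ι (suc n)         ∎

  signed : Sign → Carrier → Carrier
  signed Sign.+ x = x
  signed Sign.- x = - x

  signed-cong : ∀ s {x y} → x ≈ y → signed s x ≈ signed s y
  signed-cong Sign.+ x≈y = x≈y
  signed-cong Sign.- x≈y = -‿cong x≈y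

  signed-* : ∀ s t x y → signed (s Sign.* t) (x * y) ≈ signed s x * signed t y
  signed-* Sign.+ Sign.+ x y = refl
  signed-* Sign.+ Sign.- x y = -‿distribʳ-* x y
  signed-* Sign.- Sign.+ x y = -‿distribˡ-* x y
  signed-* Sign.- Sign.- x y = begin
    x * y         ≈⟨ ⁻¹-involutive _ ⟨
    - - (x * y)   ≈⟨ -‿cong (-‿distribˡ-* x y) ⟩
    - (- x * y)   ≈⟨ -‿distribʳ-* (- x) y ⟩
    - x * - y     ∎

  ◃-homo : ∀ s n → ⟦ s ℤ.◃ n ⟧ℤ ≈ signed s (ι n)
  ◃-homo Sign.+ zero    = refl
  ◃-homo Sign.- zero    = sym ε⁻¹≈ε
  ◃-homo Sign.+ (suc n) = refl
  ◃-homo Sign.- (suc n) = refl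

  sign-abs : ∀ i → ⟦ i ⟧ℤ ≈ signed (ℤ.sign i) (ι ℤ.∣ i ∣)
  sign-abs (+ n)      = refl
  sign-abs -[1+ n ]   = refl

  *-homo : ∀ i j → ⟦ i ℤ.* j ⟧ℤ ≈ ⟦ i ⟧ℤ * ⟦ j ⟧ℤ
  *-homo i j = begin
    ⟦ i ℤ.* j ⟧ℤ                                     ≈⟨ ◃-homo (s Sign.* t) (ℤ.∣ i ∣ ℕ.* ℤ.∣ j ∣) ⟩
    signed (s Sign.* t) (ι (ℤ.∣ i ∣ ℕ.* ℤ.∣ j ∣))     ≈⟨ signed-cong (s Sign.* t) (×1-homo-* ℤ.∣ i ∣ ℤ.∣ j ∣) ⟩
    signed (s Sign.* t) (ι ℤ.∣ i ∣ * ι ℤ.∣ j ∣)       ≈⟨ signed-* s t _ _ ⟩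
    signed s (ι ℤ.∣ i ∣) * signed t (ι ℤ.∣ j ∣)       ≈⟨ *-cong (sign-abs i) (sign-abs j) ⟨
    ⟦ i ⟧ℤ * ⟦ j ⟧ℤ                                  ∎
    where
    s t : Sign
    s = ℤ.sign i
    t = ℤ.sign j

  -‿homo : ∀ i → ⟦ ℤ.- i ⟧ℤ ≈ - ⟦ i ⟧ℤ
  -‿homo +0         = sym ε⁻¹≈ε
  -‿homo +[1+ n ]   = refl
  -‿homo -[1+ n ]   = sym (⁻¹-involutive _)

  morphism : ℤ.+-*-rawRing -Raw-AlmostCommutative⟶ fromCommutativeRing R
  morphism = record
    { ⟦_⟧ = ⟦_⟧ℤ ; +-homo = +-homo ; *-homo = *-homo ; -‿homo = -‿homo
    ; 0-homo = refl ; 1-homo = refl }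

  ≟-coefficients : WeaklyDecidable (λ i j → ⟦ i ⟧ℤ ≈ ⟦ j ⟧ℤ)
  ≟-coefficients i j with i ℤ.≟ j
  ... | yes ≡.refl = just refl
  ... | no  _      = nothing

  open import Algebra.Solver.Ring ℤ.+-*-rawRing (fromCommutativeRing R) morphism ≟-coefficients public

  :0 :1 : ∀ {n} → Polynomial n
  :0 = con (+ 0)
  :1 = con (+ 1)

-- The polynomial ring R[X]

module _ {ℓ₁ ℓ₂ : Level} (S : CommutativeRing ℓ₁ ℓ₂) where
  open CommutativeRing S

  NonZeroDivisor : Carrier → Set (ℓ₁ ⊔ ℓ₂)
  NonZeroDivisor x = ∀ z → x * z ≈ 0# → z ≈ 0#

module Polynomial {ℓ₁ ℓ₂ : Level} (R : CommutativeRing ℓ₁ ℓ₂) where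
  open CommutativeRing R hiding (isCommutativeRing)
  open import Algebra.Properties.Group +-group using (ε⁻¹≈ε; x∙y⁻¹≈ε⇒x≈y)
  Poly : Set ℓ₁
  Poly = List Carrier

  coeff : Poly → ℕ → Carrier
  coeff []      n       = 0#
  coeff (x ∷ p) zero    = x
  coeff (x ∷ p) (suc n) = coeff p n

  infix 4 _≋_
  record _≋_ (p r : Poly) : Set ℓ₂ where
    constructor coeffwise
    field coeff-≈ : ∀ n → coeff p n ≈ coeff r n
  open _≋_

  ≋-refl : ∀ {p} → p ≋ p
  ≋-refl = coeffwise λ _ → refl

  ≋-sym : ∀ {p r} → p ≋ r → r ≋ p
  ≋-sym e = coeffwise λ n → sym (coeff-≈ e n)

  ≋-trans : ∀ {p r s} → p ≋ r → r ≋ s → p ≋ s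
  ≋-trans e f = coeffwise λ n → trans (coeff-≈ e n) (coeff-≈ f n)

  ≋-setoid : Setoid ℓ₁ ℓ₂
  ≋-setoid = record
    { Carrier = Poly ; _≈_ = _≋_
    ; isEquivalence = record { refl = ≋-refl ; sym = ≋-sym ; trans = ≋-trans } }

  module ≋-Reasoning = SetoidReasoning ≋-setoid

  ∷-cong : ∀ {x y p r} → x ≈ y → p ≋ r → x ∷ p ≋ y ∷ r
  ∷-cong x≈y p≋r = coeffwise λ { zero → x≈y ; (suc n) → coeff-≈ p≋r n }

  tail-≋ : ∀ {x y p r} → x ∷ p ≋ y ∷ r → p ≋ r
  tail-≋ e = coeffwise λ n → coeff-≈ e (suc n)

  0∷[]≋[] : 0# ∷ [] ≋ []
  0∷[]≋[] = coeffwise λ { zero → refl ; (suc n) → refl }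

  infixl 6 _+ₚ_
  infixl 7 _*ₚ_ _·_
  infix  8 -ₚ_

  _+ₚ_ : Poly → Poly → Poly
  []      +ₚ r       = r
  (x ∷ p) +ₚ []      = x ∷ p
  (x ∷ p) +ₚ (y ∷ r) = x + y ∷ p +ₚ r

  -ₚ_ : Poly → Poly
  -ₚ_ = map (-_)

  _·_ : Carrier → Poly → Poly
  c · p = map (c *_) p

  _*ₚ_ : Poly → Poly → Poly
  []      *ₚ r = []
  (x ∷ p) *ₚ r = x · r +ₚ (0# ∷ p *ₚ r)

  1ₚ : Poly
  1ₚ = 1# ∷ []

  module _ where
    open SetoidReasoning setoid

    coeff-+ₚ : ∀ p r n → coeff (p +ₚ r) n ≈ coeff p n + coeff r n
    coeff-+ₚ []      r       n       = sym (+-identityˡ _)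
    coeff-+ₚ (x ∷ p) []      n       = sym (+-identityʳ _)
    coeff-+ₚ (x ∷ p) (y ∷ r) zero    = refl
    coeff-+ₚ (x ∷ p) (y ∷ r) (suc n) = coeff-+ₚ p r n

    coeff--ₚ : ∀ p n → coeff (-ₚ p) n ≈ - coeff p n
    coeff--ₚ []      n       = sym ε⁻¹≈ε
    coeff--ₚ (x ∷ p) zero    = refl
    coeff--ₚ (x ∷ p) (suc n) = coeff--ₚ p n

    coeff-· : ∀ c p n → coeff (c · p) n ≈ c * coeff p n
    coeff-· c []      n       = sym (zeroʳ c)
    coeff-· c (x ∷ p) zero    = refl
    coeff-· c (x ∷ p) (suc n) = coeff-· c p n

    +ₚ-cong : ∀ {p p′ r r′} → p ≋ p′ → r ≋ r′ → p +ₚ r ≋ p′ +ₚ r′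
    +ₚ-cong {p} {p′} {r} {r′} e f = coeffwise λ n → begin
      coeff (p +ₚ r) n       ≈⟨ coeff-+ₚ p r n ⟩
      coeff p n + coeff r n   ≈⟨ +-cong (coeff-≈ e n) (coeff-≈ f n) ⟩
      coeff p′ n + coeff r′ n ≈⟨ coeff-+ₚ p′ r′ n ⟨
      coeff (p′ +ₚ r′) n     ∎

    +ₚ-congˡ : ∀ p {r r′} → r ≋ r′ → p +ₚ r ≋ p +ₚ r′
    +ₚ-congˡ p = +ₚ-cong (≋-refl {p})

    +ₚ-congʳ : ∀ r {p p′} → p ≋ p′ → p +ₚ r ≋ p′ +ₚ r
    +ₚ-congʳ r e = +ₚ-cong e (≋-refl {r})

    -ₚ-cong : ∀ {p p′} → p ≋ p′ → -ₚ p ≋ -ₚ p′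
    -ₚ-cong {p} {p′} e = coeffwise λ n →
      trans (coeff--ₚ p n) (trans (-‿cong (coeff-≈ e n)) (sym (coeff--ₚ p′ n)))

    ·-cong : ∀ {c c′ p p′} → c ≈ c′ → p ≋ p′ → c · p ≋ c′ · p′
    ·-cong {c} {c′} {p} {p′} c≈c′ e = coeffwise λ n →
      trans (coeff-· c p n) (trans (*-cong c≈c′ (coeff-≈ e n)) (sym (coeff-· c′ p′ n)))

    +ₚ-assoc : ∀ p r s → (p +ₚ r) +ₚ s ≋ p +ₚ (r +ₚ s)
    +ₚ-assoc p r s = coeffwise λ n → begin
      coeff ((p +ₚ r) +ₚ s) n                 ≈⟨ coeff-+ₚ (p +ₚ r) s n ⟩
      coeff (p +ₚ r) n + coeff s n             ≈⟨ +-congʳ (coeff-+ₚ p r n) ⟩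
      (coeff p n + coeff r n) + coeff s n       ≈⟨ +-assoc _ _ _ ⟩
      coeff p n + (coeff r n + coeff s n)       ≈⟨ +-congˡ (coeff-+ₚ r s n) ⟨
      coeff p n + coeff (r +ₚ s) n             ≈⟨ coeff-+ₚ p (r +ₚ s) n ⟨
      coeff (p +ₚ (r +ₚ s)) n                 ∎

    +ₚ-comm : ∀ p r → p +ₚ r ≋ r +ₚ p
    +ₚ-comm p r = coeffwise λ n →
      trans (coeff-+ₚ p r n) (trans (+-comm _ _) (sym (coeff-+ₚ r p n)))

    +ₚ-identityʳ : ∀ p → p +ₚ [] ≋ p
    +ₚ-identityʳ p = coeffwise λ n → trans (coeff-+ₚ p [] n) (+-identityʳ _)

    -ₚ-inverseʳ : ∀ p → p +ₚ -ₚ p ≋ []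
    -ₚ-inverseʳ p = coeffwise λ n → begin
      coeff (p +ₚ -ₚ p) n        ≈⟨ coeff-+ₚ p (-ₚ p) n ⟩
      coeff p n + coeff (-ₚ p) n ≈⟨ +-congˡ (coeff--ₚ p n) ⟩
      coeff p n - coeff p n      ≈⟨ -‿inverseʳ _ ⟩
      0#                         ∎

    ·-distribˡ : ∀ c p r → c · (p +ₚ r) ≋ c · p +ₚ c · r
    ·-distribˡ c p r = coeffwise λ n → begin
      coeff (c · (p +ₚ r)) n              ≈⟨ coeff-· c (p +ₚ r) n ⟩
      c * coeff (p +ₚ r) n                ≈⟨ *-congˡ (coeff-+ₚ p r n) ⟩
      c * (coeff p n + coeff r n)         ≈⟨ distribˡ c _ _ ⟩
      c * coeff p n + c * coeff r n       ≈⟨ +-cong (coeff-· c p n) (coeff-· c r n) ⟨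
      coeff (c · p) n + coeff (c · r) n   ≈⟨ coeff-+ₚ (c · p) (c · r) n ⟨
      coeff (c · p +ₚ c · r) n            ∎

    ·-distribʳ : ∀ c d p → (c + d) · p ≋ c · p +ₚ d · p
    ·-distribʳ c d p = coeffwise λ n → begin
      coeff ((c + d) · p) n               ≈⟨ coeff-· (c + d) p n ⟩
      (c + d) * coeff p n                 ≈⟨ distribʳ _ c d ⟩
      c * coeff p n + d * coeff p n       ≈⟨ +-cong (coeff-· c p n) (coeff-· d p n) ⟨
      coeff (c · p) n + coeff (d · p) n   ≈⟨ coeff-+ₚ (c · p) (d · p) n ⟨
      coeff (c · p +ₚ d · p) n            ∎

    ·-assoc : ∀ c d p → c · (d · p) ≋ (c * d) · p
    ·-assoc c d p = coeffwise λ n → begin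
      coeff (c · (d · p)) n   ≈⟨ coeff-· c (d · p) n ⟩
      c * coeff (d · p) n     ≈⟨ *-congˡ (coeff-· d p n) ⟩
      c * (d * coeff p n)     ≈⟨ *-assoc c d _ ⟨
      c * d * coeff p n       ≈⟨ coeff-· (c * d) p n ⟨
      coeff ((c * d) · p) n   ∎

    ·-zeroˡ : ∀ {c} p → c ≈ 0# → c · p ≋ []
    ·-zeroˡ {c} p c≈0 = coeffwise λ n →
      trans (coeff-· c p n) (trans (*-congʳ c≈0) (zeroˡ _))

    ·-identityˡ : ∀ p → 1# · p ≋ p
    ·-identityˡ p = coeffwise λ n → trans (coeff-· 1# p n) (*-identityˡ _)

  module _ where
    open ≋-Reasoning

    +ₚ-interchange : ∀ p r s t → (p +ₚ r) +ₚ (s +ₚ t) ≋ (p +ₚ s) +ₚ (r +ₚ t)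
    +ₚ-interchange p r s t = begin
      (p +ₚ r) +ₚ (s +ₚ t) ≈⟨ +ₚ-assoc p r (s +ₚ t) ⟩
      p +ₚ (r +ₚ (s +ₚ t)) ≈⟨ +ₚ-congˡ p (+ₚ-assoc r s t) ⟨
      p +ₚ ((r +ₚ s) +ₚ t) ≈⟨ +ₚ-congˡ p (+ₚ-congʳ t (+ₚ-comm r s)) ⟩
      p +ₚ ((s +ₚ r) +ₚ t) ≈⟨ +ₚ-congˡ p (+ₚ-assoc s r t) ⟩
      p +ₚ (s +ₚ (r +ₚ t)) ≈⟨ +ₚ-assoc p s (r +ₚ t) ⟨
      (p +ₚ s) +ₚ (r +ₚ t) ∎

    +ₚ-lcomm : ∀ p r s → p +ₚ (r +ₚ s) ≋ r +ₚ (p +ₚ s)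
    +ₚ-lcomm p r s = begin
      p +ₚ (r +ₚ s) ≈⟨ +ₚ-assoc p r s ⟨
      (p +ₚ r) +ₚ s ≈⟨ +ₚ-congʳ s (+ₚ-comm p r) ⟩
      (r +ₚ p) +ₚ s ≈⟨ +ₚ-assoc r p s ⟩
      r +ₚ (p +ₚ s) ∎

    *ₚ-congʳ : ∀ p {r r′} → r ≋ r′ → p *ₚ r ≋ p *ₚ r′
    *ₚ-congʳ []      e = ≋-refl
    *ₚ-congʳ (x ∷ p) e = +ₚ-cong (·-cong refl e) (∷-cong refl (*ₚ-congʳ p e))

    *ₚ-zeroʳ : ∀ p → p *ₚ [] ≋ []
    *ₚ-zeroʳ []      = ≋-refl
    *ₚ-zeroʳ (x ∷ p) = ≋-trans (∷-cong refl (*ₚ-zeroʳ p)) 0∷[]≋[]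

    *ₚ-∷ʳ : ∀ p y r → p *ₚ (y ∷ r) ≋ y · p +ₚ (0# ∷ p *ₚ r)
    *ₚ-∷ʳ []      y r = ≋-sym 0∷[]≋[]
    *ₚ-∷ʳ (x ∷ p) y r = ∷-cong (+-congʳ (*-comm x y)) (begin
      x · r +ₚ p *ₚ (y ∷ r)              ≈⟨ +ₚ-congˡ (x · r) (*ₚ-∷ʳ p y r) ⟩
      x · r +ₚ (y · p +ₚ (0# ∷ p *ₚ r))  ≈⟨ +ₚ-lcomm (x · r) (y · p) _ ⟩
      y · p +ₚ (x · r +ₚ (0# ∷ p *ₚ r))  ∎)

    *ₚ-comm : ∀ p r → p *ₚ r ≋ r *ₚ p
    *ₚ-comm []      r = ≋-sym (*ₚ-zeroʳ r)
    *ₚ-comm (x ∷ p) r = begin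
      x · r +ₚ (0# ∷ p *ₚ r) ≈⟨ +ₚ-congˡ (x · r) (∷-cong refl (*ₚ-comm p r)) ⟩
      x · r +ₚ (0# ∷ r *ₚ p) ≈⟨ *ₚ-∷ʳ r x p ⟨
      r *ₚ (x ∷ p)           ∎

    *ₚ-congˡ : ∀ {p p′} r → p ≋ p′ → p *ₚ r ≋ p′ *ₚ r
    *ₚ-congˡ {p} {p′} r e = begin
      p *ₚ r  ≈⟨ *ₚ-comm p r ⟩
      r *ₚ p  ≈⟨ *ₚ-congʳ r e ⟩
      r *ₚ p′ ≈⟨ *ₚ-comm r p′ ⟩
      p′ *ₚ r ∎

    *ₚ-distribʳ : ∀ p r s → (p +ₚ r) *ₚ s ≋ p *ₚ s +ₚ r *ₚ s
    *ₚ-distribʳ []      r       s = ≋-refl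
    *ₚ-distribʳ (x ∷ p) []      s = ≋-sym (+ₚ-identityʳ _)
    *ₚ-distribʳ (x ∷ p) (y ∷ r) s = begin
      (x + y) · s +ₚ (0# ∷ (p +ₚ r) *ₚ s)
        ≈⟨ +ₚ-cong (·-distribʳ x y s) (∷-cong (sym (+-identityʳ 0#)) (*ₚ-distribʳ p r s)) ⟩
      (x · s +ₚ y · s) +ₚ ((0# ∷ p *ₚ s) +ₚ (0# ∷ r *ₚ s))
        ≈⟨ +ₚ-interchange (x · s) (y · s) _ _ ⟩
      (x · s +ₚ (0# ∷ p *ₚ s)) +ₚ (y · s +ₚ (0# ∷ r *ₚ s)) ∎

    *ₚ-distribˡ : ∀ p r s → p *ₚ (r +ₚ s) ≋ p *ₚ r +ₚ p *ₚ s
    *ₚ-distribˡ p r s = begin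
      p *ₚ (r +ₚ s)      ≈⟨ *ₚ-comm p (r +ₚ s) ⟩
      (r +ₚ s) *ₚ p      ≈⟨ *ₚ-distribʳ r s p ⟩
      r *ₚ p +ₚ s *ₚ p   ≈⟨ +ₚ-cong (*ₚ-comm r p) (*ₚ-comm s p) ⟩
      p *ₚ r +ₚ p *ₚ s   ∎

    ·-*ₚ : ∀ c p r → (c · p) *ₚ r ≋ c · (p *ₚ r)
    ·-*ₚ c []      r = ≋-refl
    ·-*ₚ c (x ∷ p) r = begin
      (c * x) · r +ₚ (0# ∷ (c · p) *ₚ r)
        ≈⟨ +ₚ-cong (≋-sym (·-assoc c x r)) (∷-cong (sym (zeroʳ c)) (·-*ₚ c p r)) ⟩
      c · (x · r) +ₚ c · (0# ∷ p *ₚ r)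
        ≈⟨ ·-distribˡ c (x · r) _ ⟨
      c · (x · r +ₚ (0# ∷ p *ₚ r)) ∎

    0∷-*ₚ : ∀ p r → (0# ∷ p) *ₚ r ≋ 0# ∷ p *ₚ r
    0∷-*ₚ p r = +ₚ-congʳ (0# ∷ p *ₚ r) (·-zeroˡ r refl)

    *ₚ-assoc : ∀ p r s → (p *ₚ r) *ₚ s ≋ p *ₚ (r *ₚ s)
    *ₚ-assoc []      r s = ≋-refl
    *ₚ-assoc (x ∷ p) r s = begin
      (x · r +ₚ (0# ∷ p *ₚ r)) *ₚ s        ≈⟨ *ₚ-distribʳ (x · r) _ s ⟩
      (x · r) *ₚ s +ₚ (0# ∷ p *ₚ r) *ₚ s  ≈⟨ +ₚ-cong (·-*ₚ x r s) (0∷-*ₚ (p *ₚ r) s) ⟩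
      x · (r *ₚ s) +ₚ (0# ∷ (p *ₚ r) *ₚ s) ≈⟨ +ₚ-congˡ (x · (r *ₚ s)) (∷-cong refl (*ₚ-assoc p r s)) ⟩
      x · (r *ₚ s) +ₚ (0# ∷ p *ₚ (r *ₚ s)) ∎

    *ₚ-identityˡ : ∀ p → 1ₚ *ₚ p ≋ p
    *ₚ-identityˡ p = begin
      1# · p +ₚ (0# ∷ []) ≈⟨ +ₚ-cong (·-identityˡ p) 0∷[]≋[] ⟩
      p +ₚ []             ≈⟨ +ₚ-identityʳ p ⟩
      p                   ∎

    isCommutativeRing : IsCommutativeRing _≋_ _+ₚ_ _*ₚ_ -ₚ_ [] 1ₚ
    isCommutativeRing = record
      { isRing = record
        { +-isAbelianGroup = record
          { isGroup = record
            { isMonoid = record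
              { isSemigroup = record
                { isMagma = record
                  { isEquivalence = Setoid.isEquivalence ≋-setoid
                  ; ∙-cong        = +ₚ-cong
                  }
                ; assoc = +ₚ-assoc
                }
              ; identity = (λ _ → ≋-refl) , +ₚ-identityʳ
              }
            ; inverse = (λ p → ≋-trans (+ₚ-comm (-ₚ p) p) (-ₚ-inverseʳ p)) , -ₚ-inverseʳ
            ; ⁻¹-cong = -ₚ-cong
            }
          ; comm = +ₚ-comm
          }
        ; *-cong     = λ {p} {p′} {r} e f → ≋-trans (*ₚ-congˡ r e) (*ₚ-congʳ p′ f)
        ; *-assoc    = *ₚ-assoc
        ; *-identity = *ₚ-identityˡ , λ p → ≋-trans (*ₚ-comm p 1ₚ) (*ₚ-identityˡ p)
        ; distrib    = *ₚ-distribˡ , λ s p r → *ₚ-distribʳ p r s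
        }
      ; *-comm = *ₚ-comm
      }

  polynomialRing : CommutativeRing ℓ₁ ℓ₂
  polynomialRing = record { isCommutativeRing = isCommutativeRing }

  X : Poly
  X = 0# ∷ 1# ∷ []

  const : Carrier → Poly
  const c = c ∷ []

  const-isRingHomomorphism : RingMorphisms.IsRingHomomorphism rawRing (CommutativeRing.rawRing polynomialRing) const
  const-isRingHomomorphism = record
    { isSemiringHomomorphism = record
      { isNearSemiringHomomorphism = record
        { +-isMonoidHomomorphism = record
          { isMagmaHomomorphism = record
            { isRelHomomorphism = record { cong = λ e → ∷-cong e ≋-refl }
            ; homo = λ _ _ → ≋-refl
            }
          ; ε-homo = 0∷[]≋[]
          }
        ; *-homo = λ x y → ≋-sym (≋-trans (+ₚ-congˡ (x · const y) 0∷[]≋[]) (+ₚ-identityʳ _))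
        }
      ; 1#-homo = ≋-refl
      }
    ; -‿homo = λ _ → ≋-refl
    }

  X-*ₚ : ∀ p → X *ₚ p ≋ 0# ∷ p
  X-*ₚ p = +ₚ-cong (·-zeroˡ p refl) (∷-cong refl (*ₚ-identityˡ p))

  const-*ₚ : ∀ c p → const c *ₚ p ≋ c · p
  const-*ₚ c p = ≋-trans (+ₚ-congˡ (c · p) 0∷[]≋[]) (+ₚ-identityʳ (c · p))

  1-cX²-nonZeroDivisor : ∀ {C} c → C ≋ const c →
                         NonZeroDivisor polynomialRing (1ₚ +ₚ -ₚ (C *ₚ X *ₚ X))
  1-cX²-nonZeroDivisor {C} c C≋c z vanishes = coeffwise λ n → proj₁ (vanishing n)
    where
    open IntegerCoefficientSolver polynomialRing using (solve; _:=_; _:-_; _:*_; :1)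

    expand : (1ₚ +ₚ -ₚ (C *ₚ X *ₚ X)) *ₚ z ≋ z +ₚ -ₚ (c · (0# ∷ 0# ∷ z))
    expand = begin
      (1ₚ +ₚ -ₚ (C *ₚ X *ₚ X)) *ₚ z   ≈⟨ solve 3 (λ C X z → (:1 :- C :* X :* X) :* z := z :- C :* (X :* (X :* z))) ≋-refl C X z ⟩
      z +ₚ -ₚ (C *ₚ (X *ₚ (X *ₚ z))) ≈⟨ +ₚ-congˡ z (-ₚ-cong (*ₚ-congʳ C (≋-trans (*ₚ-congʳ X (X-*ₚ z)) (X-*ₚ (0# ∷ z))))) ⟩
      z +ₚ -ₚ (C *ₚ (0# ∷ 0# ∷ z))    ≈⟨ +ₚ-congˡ z (-ₚ-cong (≋-trans (*ₚ-congˡ _ C≋c) (const-*ₚ c _))) ⟩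
      z +ₚ -ₚ (c · (0# ∷ 0# ∷ z))     ∎
      where open ≋-Reasoning

    recurrence : ∀ n → coeff z n ≈ c * coeff (0# ∷ 0# ∷ z) n
    recurrence n = x∙y⁻¹≈ε⇒x≈y _ _ (begin
      coeff z n - c * coeff (0# ∷ 0# ∷ z) n   ≈⟨ +-congˡ (-‿cong (coeff-· c (0# ∷ 0# ∷ z) n)) ⟨
      coeff z n - coeff (c · (0# ∷ 0# ∷ z)) n ≈⟨ +-congˡ (coeff--ₚ (c · (0# ∷ 0# ∷ z)) n) ⟨
      coeff z n + coeff (-ₚ (c · (0# ∷ 0# ∷ z))) n ≈⟨ coeff-+ₚ z _ n ⟨
      coeff (z +ₚ -ₚ (c · (0# ∷ 0# ∷ z))) n   ≈⟨ coeff-≈ (≋-trans (≋-sym expand) vanishes) n ⟩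
      0#                                      ∎)
      where open SetoidReasoning setoid

    vanishing : ∀ n → coeff z n ≈ 0# × coeff z (suc n) ≈ 0#
    vanishing zero    = trans (recurrence 0) (zeroʳ c) , trans (recurrence 1) (zeroʳ c)
    vanishing (suc n) = proj₂ (vanishing n)
                      , trans (recurrence (suc (suc n))) (trans (*-congˡ (proj₁ (vanishing n))) (zeroʳ c))

  eval : Carrier → Poly → Carrier
  eval t []      = 0#
  eval t (x ∷ p) = x + t * eval t p

  module _ (t : Carrier) where
    open SetoidReasoning setoid
    open IntegerCoefficientSolver R using (solve; _:=_; _:+_; _:*_; :-_; :0)

    eval-≋[] : ∀ {p} → p ≋ [] → eval t p ≈ 0#
    eval-≋[] {[]}    _ = refl
    eval-≋[] {x ∷ p} e = begin
      x + t * eval t p ≈⟨ +-cong (coeff-≈ e 0) (*-congˡ (eval-≋[] {p} (coeffwise λ n → coeff-≈ e (suc n)))) ⟩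
      0# + t * 0#      ≈⟨ +-identityˡ _ ⟩
      t * 0#           ≈⟨ zeroʳ t ⟩
      0#               ∎

    eval-cong : ∀ {p r} → p ≋ r → eval t p ≈ eval t r
    eval-cong {[]}    {r}     e = sym (eval-≋[] (≋-sym e))
    eval-cong {x ∷ p} {[]}    e = eval-≋[] e
    eval-cong {x ∷ p} {y ∷ r} e = +-cong (coeff-≈ e 0) (*-congˡ (eval-cong (tail-≋ e)))

    eval-+ₚ : ∀ p r → eval t (p +ₚ r) ≈ eval t p + eval t r
    eval-+ₚ []      r       = sym (+-identityˡ _)
    eval-+ₚ (x ∷ p) []      = sym (+-identityʳ _)
    eval-+ₚ (x ∷ p) (y ∷ r) = begin
      (x + y) + t * eval t (p +ₚ r)            ≈⟨ +-congˡ (*-congˡ (eval-+ₚ p r)) ⟩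
      (x + y) + t * (eval t p + eval t r)      ≈⟨ solve 5 (λ x y t e f → (x :+ y) :+ t :* (e :+ f) := (x :+ t :* e) :+ (y :+ t :* f)) refl x y t _ _ ⟩
      (x + t * eval t p) + (y + t * eval t r)  ∎

    eval-· : ∀ c p → eval t (c · p) ≈ c * eval t p
    eval-· c []      = sym (zeroʳ c)
    eval-· c (x ∷ p) = begin
      c * x + t * eval t (c · p)  ≈⟨ +-congˡ (*-congˡ (eval-· c p)) ⟩
      c * x + t * (c * eval t p)  ≈⟨ solve 4 (λ c x t e → c :* x :+ t :* (c :* e) := c :* (x :+ t :* e)) refl c x t _ ⟩
      c * (x + t * eval t p)      ∎

    eval-*ₚ : ∀ p r → eval t (p *ₚ r) ≈ eval t p * eval t r
    eval-*ₚ []      r = sym (zeroˡ _)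
    eval-*ₚ (x ∷ p) r = begin
      eval t (x · r +ₚ (0# ∷ p *ₚ r))                ≈⟨ eval-+ₚ (x · r) (0# ∷ p *ₚ r) ⟩
      eval t (x · r) + (0# + t * eval t (p *ₚ r))     ≈⟨ +-cong (eval-· x r) (+-congˡ (*-congˡ (eval-*ₚ p r))) ⟩
      x * eval t r + (0# + t * (eval t p * eval t r)) ≈⟨ solve 4 (λ x t e f → x :* f :+ (:0 :+ t :* (e :* f)) := (x :+ t :* e) :* f) refl x t _ _ ⟩
      (x + t * eval t p) * eval t r                   ∎

    eval--ₚ : ∀ p → eval t (-ₚ p) ≈ - eval t p
    eval--ₚ []      = sym ε⁻¹≈ε
    eval--ₚ (x ∷ p) = begin
      - x + t * eval t (-ₚ p)  ≈⟨ +-congˡ (*-congˡ (eval--ₚ p)) ⟩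
      - x + t * - eval t p     ≈⟨ solve 3 (λ x t e → :- x :+ t :* (:- e) := :- (x :+ t :* e)) refl x t _ ⟩
      - (x + t * eval t p)     ∎

    eval-const : ∀ c → eval t (const c) ≈ c
    eval-const c = trans (+-congˡ (zeroʳ t)) (+-identityʳ c)

    eval-X : eval t X ≈ t
    eval-X = trans (+-identityˡ _) (trans (*-congˡ (eval-const 1#)) (*-identityʳ t))

    eval-isRingHomomorphism : RingMorphisms.IsRingHomomorphism (CommutativeRing.rawRing polynomialRing) rawRing (eval t)
    eval-isRingHomomorphism = record
      { isSemiringHomomorphism = record
        { isNearSemiringHomomorphism = record
          { +-isMonoidHomomorphism = record
            { isMagmaHomomorphism = record
              { isRelHomomorphism = record { cong = eval-cong }
              ; homo = eval-+ₚ
              }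
            ; ε-homo = refl
            }
          ; *-homo = eval-*ₚ
          }
        ; 1#-homo = eval-const 1#
        }
      ; -‿homo = eval--ₚ
      }

module HomomorphicImage
  {a₁ ℓ₁ a₂ ℓ₂ : Level} (A : CommutativeRing a₁ ℓ₁) (B : CommutativeRing a₂ ℓ₂)
  {φ : CommutativeRing.Carrier A → CommutativeRing.Carrier B}
  (φ-isRingHomomorphism : RingMorphisms.IsRingHomomorphism
                            (CommutativeRing.rawRing A) (CommutativeRing.rawRing B) φ)
  where
  private module A = CommutativeRing A
  open CommutativeRing B
  open RingMorphisms.IsRingHomomorphism φ-isRingHomomorphism
    using (+-homo; *-homo; -‿homo; 0#-homo; 1#-homo)

  infixl 6 _⟨+⟩_ _⟨-⟩_
  infixl 7 _⟨*⟩_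

  _⟨+⟩_ : ∀ {x y x′ y′} → φ x ≈ x′ → φ y ≈ y′ → φ (x A.+ y) ≈ x′ + y′
  x↦ ⟨+⟩ y↦ = trans (+-homo _ _) (+-cong x↦ y↦)

  _⟨*⟩_ : ∀ {x y x′ y′} → φ x ≈ x′ → φ y ≈ y′ → φ (x A.* y) ≈ x′ * y′
  x↦ ⟨*⟩ y↦ = trans (*-homo _ _) (*-cong x↦ y↦)

  _⟨-⟩_ : ∀ {x y x′ y′} → φ x ≈ x′ → φ y ≈ y′ → φ (x A.- y) ≈ x′ - y′
  x↦ ⟨-⟩ y↦ = trans (+-homo _ _) (+-cong x↦ (trans (-‿homo _) (-‿cong y↦)))

  ⟨0⟩ : φ A.0# ≈ 0#
  ⟨0⟩ = 0#-homo

  ⟨1⟩ : φ A.1# ≈ 1#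
  ⟨1⟩ = 1#-homo

  ⟨pow⟩ : ∀ n {x x′} → φ x ≈ x′ → φ (pow A x n) ≈ pow B x′ n
  ⟨pow⟩ zero    x↦ = ⟨1⟩
  ⟨pow⟩ (suc n) x↦ = x↦ ⟨*⟩ ⟨pow⟩ n x↦

  module _ {a b c d q qi a′ b′ c′ d′ q′ qi′}
           (a↦ : φ a ≈ a′) (b↦ : φ b ≈ b′) (c↦ : φ c ≈ c′) (d↦ : φ d ≈ d′)
           (q↦ : φ q ≈ q′) (qi↦ : φ qi ≈ qi′) where

    F-homo : ∀ m {y y′} → φ y ≈ y′ →
             φ (F A a b c d q qi m y) ≈ F B a′ b′ c′ d′ q′ qi′ m y′
    F-homo m {y} {y′} y↦ = proj₁ (consecutive m)
      where
      consecutive : ∀ m → φ (F A a b c d q qi m y) ≈ F B a′ b′ c′ d′ q′ qi′ m y′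
                        × φ (F A a b c d q qi (suc m) y) ≈ F B a′ b′ c′ d′ q′ qi′ (suc m) y′
      consecutive zero =
        ⟨1⟩ ,
        (b↦ ⟨+⟩ d↦ ⟨-⟩ y↦ ⟨*⟩ (a↦ ⟨+⟩ c↦) ⟨*⟩ ⟨1⟩) ⟨*⟩ ⟨1⟩
          ⟨+⟩ (⟨1⟩ ⟨-⟩ ⟨1⟩) ⟨*⟩ (b↦ ⟨*⟩ d↦ ⟨-⟩ a↦ ⟨*⟩ c↦ ⟨*⟩ ⟨pow⟩ 1 qi↦ ⟨*⟩ ⟨pow⟩ 2 y↦) ⟨*⟩ ⟨0⟩
      consecutive (suc m) with consecutive m
      ... | Fm↦ , Fsm↦ = Fsm↦ ,
        (b↦ ⟨+⟩ d↦ ⟨-⟩ y↦ ⟨*⟩ (a↦ ⟨+⟩ c↦) ⟨*⟩ ⟨pow⟩ (suc m) q↦) ⟨*⟩ Fsm↦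
          ⟨+⟩ (⟨pow⟩ (suc m) q↦ ⟨-⟩ ⟨1⟩) ⟨*⟩ (b↦ ⟨*⟩ d↦ ⟨-⟩ a↦ ⟨*⟩ c↦ ⟨*⟩ ⟨pow⟩ m q↦ ⟨*⟩ ⟨pow⟩ 2 y↦) ⟨*⟩ Fm↦

    Fz-homo : ∀ i {y y′} → φ y ≈ y′ →
              φ (Fz A a b c d q qi i y) ≈ Fz B a′ b′ c′ d′ q′ qi′ i y′
    Fz-homo (+ m)    y↦ = F-homo m y↦
    Fz-homo -[1+ m ] y↦ = ⟨0⟩

-- The q-difference relation

module QDifference {ℓ₁ ℓ₂ : Level} (S : CommutativeRing ℓ₁ ℓ₂)
                   (a b c d q qi v : CommutativeRing.Carrier S) where
  open CommutativeRing S
  open import Algebra.Properties.Group +-group using (x≈y⇒x∙y⁻¹≈ε)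
  open IntegerCoefficientSolver S using (solve; _:=_; _:+_; _:-_; _:*_; :0; :1)

  e κ : Carrier
  e = a * b * c * d
  κ = e * (b + d) * v * v - b * d * (a + c) * v

  G H H⁻ : ℕ → Carrier
  G m  = F S a b c d q qi m (b * d * v)
  H m  = F S a b c d q qi m (b * d * q * v)
  H⁻ m = Fz S a b c d q qi (+ m -ℤ + 1) (b * d * q * v)

  Defect : (Q g h h⁻ : Carrier) → Carrier
  Defect Q g h h⁻ = (1# - e * Q * v * v) * g - (1# - e * v * v) * h - (1# - Q) * κ * h⁻

  defect : ℕ → Carrier
  defect m = Defect (pow S q m) (G m) (H m) (H⁻ m)

  Defect-congʳ : ∀ Q {g g′ h h′ h⁻ h⁻′} → g ≈ g′ → h ≈ h′ → h⁻ ≈ h⁻′ → Defect Q g h h⁻ ≈ Defect Q g′ h′ h⁻′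
  Defect-congʳ Q g≈g′ h≈h′ h⁻≈h⁻′ =
    +-cong (+-cong (*-congˡ g≈g′) (-‿cong (*-congˡ h≈h′))) (-‿cong (*-congˡ h⁻≈h⁻′))

  Rec : (y Q Q⁻ f f⁻ : Carrier) → Carrier
  Rec y Q Q⁻ f f⁻ = (b + d - y * (a + c) * Q) * f + (Q - 1#) * (b * d - a * c * Q⁻ * pow S y 2) * f⁻

  X₁ Y₁ : Carrier → Carrier
  X₁ P = b + d - b * d * q * v * (a + c) * P
  Y₁ P = (P - 1#) * b * d * (1# - e * (q * P) * v * v)

  -- a c q^{k-1} (bdqv)² is rewritten as bd e q^{k+1} v², which is harmless at k = 0 because
  -- the factor q^k - 1 vanishes there.
  H-rec : ∀ k → H (suc k) ≈ X₁ (pow S q k) * H k + Y₁ (pow S q k) * H⁻ k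
  H-rec zero = solve 7 (λ a b c d q qi v →
      let x = b :* d :* q :* v ; e = a :* b :* c :* d in
      (b :+ d :- x :* (a :+ c) :* :1) :* :1 :+ (:1 :- :1) :* (b :* d :- a :* c :* (qi :* :1) :* (x :* (x :* :1))) :* :0
      := (b :+ d :- x :* (a :+ c) :* :1) :* :1 :+ (:1 :- :1) :* b :* d :* (:1 :- e :* (q :* :1) :* v :* v) :* :0)
    refl a b c d q qi v
  H-rec (suc k) = solve 9 (λ a b c d q v P h h⁻ →
      let x = b :* d :* q :* v ; e = a :* b :* c :* d in
      (b :+ d :- x :* (a :+ c) :* (q :* P)) :* h :+ (q :* P :- :1) :* (b :* d :- a :* c :* P :* (x :* (x :* :1))) :* h⁻
      := (b :+ d :- x :* (a :+ c) :* (q :* P)) :* h :+ (q :* P :- :1) :* b :* d :* (:1 :- e :* (q :* (q :* P)) :* v :* v) :* h⁻)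
    refl a b c d q v (pow S q k) (H (suc k)) (H k)

  defect₀ : defect 0 ≈ 0#
  defect₀ = solve 3 (λ e v κ →
      (:1 :- e :* :1 :* v :* v) :* :1 :- (:1 :- e :* v :* v) :* :1 :- (:1 :- :1) :* κ :* :0 := :0)
    refl e v κ

  defect₁ : defect 1 ≈ 0#
  defect₁ = solve 7 (λ a b c d q qi v →
      let e  = a :* b :* c :* d
          κ  = e :* (b :+ d) :* v :* v :- b :* d :* (a :+ c) :* v
          F₁ = λ x → (b :+ d :- x :* (a :+ c) :* :1) :* :1
                     :+ (:1 :- :1) :* (b :* d :- a :* c :* (qi :* :1) :* (x :* (x :* :1))) :* :0
      in (:1 :- e :* (q :* :1) :* v :* v) :* F₁ (b :* d :* v) :- (:1 :- e :* v :* v) :* F₁ (b :* d :* q :* v)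
         :- (:1 :- q :* :1) :* κ :* :1 := :0)
    refl a b c d q qi v

  defect-step : ∀ P h₀ h₁ h₂ g₀ g₁ → h₂ ≈ X₁ P * h₁ + Y₁ P * h₀ →
                Defect P g₀ h₁ h₀ ≈ 0# → Defect (q * P) g₁ h₂ h₁ ≈ 0# →
                (1# - e * (q * P) * v * v) *
                  Defect (q * (q * P)) (Rec (b * d * v) (q * P) P g₁ g₀) (Rec (b * d * q * v) (q * P) P h₂ h₁) h₂
                ≈ 0#
  defect-step P h₀ h₁ h₂ g₀ g₁ h₂-rec vanish₀ vanish₁ = trans combination (trans
    (+-cong (+-cong (*-congˡ vanish₁) (*-congˡ vanish₀)) (*-congˡ (x≈y⇒x∙y⁻¹≈ε h₂-rec)))
    (solve 3 (λ x y z → x :* :0 :+ y :* :0 :+ z :* :0 := :0) refl c₁ c₂ c₃))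
    where
    -- c₁ and c₂ cancel the terms in g₁ and g₀; c₃ is what is left of h₂.
    c₁ c₂ c₃ : Carrier
    c₁ = (1# - e * (q * (q * P)) * v * v) * (b + d - b * d * v * (a + c) * (q * P))
    c₂ = (1# - e * (q * (q * P)) * v * v) * (1# - e * (q * P) * v * v) * (q * P - 1#) * b * d
    c₃ = c₁ * (1# - e * v * v) - (1# - e * (q * P) * v * v)
           * ((1# - e * v * v) * (b + d - b * d * q * v * (a + c) * (q * P)) + (1# - q * (q * P)) * κ)

    combination : (1# - e * (q * P) * v * v) *
                    Defect (q * (q * P)) (Rec (b * d * v) (q * P) P g₁ g₀) (Rec (b * d * q * v) (q * P) P h₂ h₁) h₂
                  ≈ c₁ * Defect (q * P) g₁ h₂ h₁ + c₂ * Defect P g₀ h₁ h₀ + c₃ * (h₂ - (X₁ P * h₁ + Y₁ P * h₀))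
    combination = solve 12 (λ a b c d q v P h₀ h₁ h₂ g₀ g₁ →
      let e = a :* b :* c :* d
          κ = e :* (b :+ d) :* v :* v :- b :* d :* (a :+ c) :* v
          Defect = λ Q g h h⁻ → (:1 :- e :* Q :* v :* v) :* g :- (:1 :- e :* v :* v) :* h :- (:1 :- Q) :* κ :* h⁻
          Rec = λ y Q Q⁻ f f⁻ → (b :+ d :- y :* (a :+ c) :* Q) :* f
                                :+ (Q :- :1) :* (b :* d :- a :* c :* Q⁻ :* (y :* (y :* :1))) :* f⁻
          X₁ = b :+ d :- b :* d :* q :* v :* (a :+ c) :* P
          Y₁ = (P :- :1) :* b :* d :* (:1 :- e :* (q :* P) :* v :* v)
          c₁ = (:1 :- e :* (q :* (q :* P)) :* v :* v) :* (b :+ d :- b :* d :* v :* (a :+ c) :* (q :* P))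
          c₂ = (:1 :- e :* (q :* (q :* P)) :* v :* v) :* (:1 :- e :* (q :* P) :* v :* v) :* (q :* P :- :1) :* b :* d
          c₃ = c₁ :* (:1 :- e :* v :* v) :- (:1 :- e :* (q :* P) :* v :* v)
                 :* ((:1 :- e :* v :* v) :* (b :+ d :- b :* d :* q :* v :* (a :+ c) :* (q :* P)) :+ (:1 :- q :* (q :* P)) :* κ)
      in (:1 :- e :* (q :* P) :* v :* v)
           :* Defect (q :* (q :* P)) (Rec (b :* d :* v) (q :* P) P g₁ g₀) (Rec (b :* d :* q :* v) (q :* P) P h₂ h₁) h₂
         := c₁ :* Defect (q :* P) g₁ h₂ h₁ :+ c₂ :* Defect P g₀ h₁ h₀ :+ c₃ :* (h₂ :- (X₁ :* h₁ :+ Y₁ :* h₀)))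
      refl a b c d q v P h₀ h₁ h₂ g₀ g₁

  defect-vanishes : (∀ k → NonZeroDivisor S (1# - e * pow S q (suc k) * v * v)) → ∀ m → defect m ≈ 0#
  defect-vanishes regular m = proj₁ (consecutive m)
    where
    consecutive : ∀ m → defect m ≈ 0# × defect (suc m) ≈ 0#
    consecutive zero    = defect₀ , defect₁
    consecutive (suc k) with consecutive k
    ... | vanish₀ , vanish₁ = vanish₁ , regular k (defect (suc (suc k)))
            (defect-step (pow S q k) (H⁻ k) (H k) (H (suc k)) (G k) (G (suc k)) (H-rec k) vanish₀ vanish₁)

module _ {a₁ ℓ₁ a₂ ℓ₂ : Level} (A : CommutativeRing a₁ ℓ₁) (B : CommutativeRing a₂ ℓ₂)
  {φ : CommutativeRing.Carrier A → CommutativeRing.Carrier B}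
  (φ-isRingHomomorphism : RingMorphisms.IsRingHomomorphism
                            (CommutativeRing.rawRing A) (CommutativeRing.rawRing B) φ)
  where
  open CommutativeRing B
  open HomomorphicImage A B φ-isRingHomomorphism

  defect-homo : ∀ a b c d q qi v {a′ b′ c′ d′ q′ qi′ v′} →
                φ a ≈ a′ → φ b ≈ b′ → φ c ≈ c′ → φ d ≈ d′ → φ q ≈ q′ → φ qi ≈ qi′ → φ v ≈ v′ →
                ∀ m → φ (QDifference.defect A a b c d q qi v m) ≈ QDifference.defect B a′ b′ c′ d′ q′ qi′ v′ m
  defect-homo a b c d q qi v {a′} {b′} {c′} {d′} {q′} {qi′} {v′} a↦ b↦ c↦ d↦ q↦ qi↦ v↦ m =
    (⟨1⟩ ⟨-⟩ e↦ ⟨*⟩ ⟨pow⟩ m q↦ ⟨*⟩ v↦ ⟨*⟩ v↦) ⟨*⟩ F-homo a↦ b↦ c↦ d↦ q↦ qi↦ m (b↦ ⟨*⟩ d↦ ⟨*⟩ v↦)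
    ⟨-⟩ (⟨1⟩ ⟨-⟩ e↦ ⟨*⟩ v↦ ⟨*⟩ v↦) ⟨*⟩ F-homo a↦ b↦ c↦ d↦ q↦ qi↦ m (b↦ ⟨*⟩ d↦ ⟨*⟩ q↦ ⟨*⟩ v↦)
    ⟨-⟩ (⟨1⟩ ⟨-⟩ ⟨pow⟩ m q↦) ⟨*⟩ κ↦ ⟨*⟩ Fz-homo a↦ b↦ c↦ d↦ q↦ qi↦ (+ m -ℤ + 1) (b↦ ⟨*⟩ d↦ ⟨*⟩ q↦ ⟨*⟩ v↦)
    where
    e↦ : φ (QDifference.e A a b c d q qi v) ≈ QDifference.e B a′ b′ c′ d′ q′ qi′ v′
    e↦ = a↦ ⟨*⟩ b↦ ⟨*⟩ c↦ ⟨*⟩ d↦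

    κ↦ : φ (QDifference.κ A a b c d q qi v) ≈ QDifference.κ B a′ b′ c′ d′ q′ qi′ v′
    κ↦ = e↦ ⟨*⟩ (b↦ ⟨+⟩ d↦) ⟨*⟩ v↦ ⟨*⟩ v↦ ⟨-⟩ b↦ ⟨*⟩ d↦ ⟨*⟩ (a↦ ⟨+⟩ c↦) ⟨*⟩ v↦

module _ {ℓ₁ ℓ₂ : Level} (R : CommutativeRing ℓ₁ ℓ₂) where
  open CommutativeRing R
  open Polynomial R

  F-q-difference : ∀ a b c d q qi v m → QDifference.defect R a b c d q qi v m ≈ 0#
  F-q-difference a b c d q qi v m = begin
    defect m                 ≈⟨ defect-homo polynomialRing R (eval-isRingHomomorphism v)
                                  (const a) (const b) (const c) (const d) (const q) (const qi) X
                                  (eval-const v a) (eval-const v b) (eval-const v c) (eval-const v d)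
                                  (eval-const v q) (eval-const v qi) (eval-X v) m ⟨
    eval v (defectₚ m)       ≈⟨ eval-cong v (defectₚ-vanishes m) ⟩
    0#                       ∎
    where
    open SetoidReasoning setoid
    open QDifference R a b c d q qi v using (defect)
    open QDifference polynomialRing (const a) (const b) (const c) (const d) (const q) (const qi) X
      using () renaming (defect to defectₚ; defect-vanishes to defectₚ-vanishes′)

    defectₚ-vanishes : ∀ m → defectₚ m ≋ []
    defectₚ-vanishes = defectₚ-vanishes′ λ k →
      1-cX²-nonZeroDivisor (a * b * c * d * pow R q (suc k))
        (≋-sym (≋-refl ⟨*⟩ ≋-refl ⟨*⟩ ≋-refl ⟨*⟩ ≋-refl ⟨*⟩ ⟨pow⟩ (suc k) ≋-refl))
      where open HomomorphicImage R polynomialRing const-isRingHomomorphism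

module _ {ℓ₁ ℓ₂ : Level} (R : CommutativeRing ℓ₁ ℓ₂) (q qi : CommutativeRing.Carrier R) where
  open CommutativeRing R

  zpow-pred : q * qi ≈ 1# → ∀ i → qi * zpow R q qi i ≈ zpow R q qi (i -ℤ + 1)
  zpow-pred q*qi≈1 (+ zero)    = refl
  zpow-pred q*qi≈1 (+ suc n)   = begin
    qi * (q * pow R q n)   ≈⟨ *-assoc qi q _ ⟨
    qi * q * pow R q n     ≈⟨ *-congʳ (trans (*-comm qi q) q*qi≈1) ⟩
    1# * pow R q n         ≈⟨ *-identityˡ _ ⟩
    pow R q n              ∎
    where open SetoidReasoning setoid
  zpow-pred q*qi≈1 -[1+ n ]    =
    reflexive (≡.cong (λ k → pow R qi (suc (suc k))) (≡.sym (ℕₚ.+-identityʳ n)))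

module _ {ℓ₁ ℓ₂ : Level} (R : CommutativeRing ℓ₁ ℓ₂) (a b c d q qi : CommutativeRing.Carrier R) where
  open CommutativeRing R
  open import Algebra.Properties.Group +-group using (x≈y⇒x∙y⁻¹≈ε)
  open IntegerCoefficientSolver R using (solve; _:=_; _:+_; _:-_; _:*_; :0; :1)

  F-rec : ∀ n y → F R a b c d q qi (suc n) y ≡
      (b + d - y * (a + c) * zpow R q qi (+ suc n -ℤ + 1)) * Fz R a b c d q qi (+ suc n -ℤ + 1) y
    + (zpow R q qi (+ suc n -ℤ + 1) - 1#) * (b * d - a * c * zpow R q qi (+ suc n -ℤ + 2) * pow R y 2)
      * Fz R a b c d q qi (+ suc n -ℤ + 2) y
  F-rec zero    y = ≡.refl
  F-rec (suc n) y = ≡.refl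

  module _ where
    open HomomorphicImage R R (id-isRingHomomorphism rawRing refl)

    F-cong : ∀ m {y y′} → y ≈ y′ → F R a b c d q qi m y ≈ F R a b c d q qi m y′
    F-cong = F-homo refl refl refl refl refl refl

    Fz-cong : ∀ i {y y′} → y ≈ y′ → Fz R a b c d q qi i y ≈ Fz R a b c d q qi i y′
    Fz-cong = Fz-homo refl refl refl refl refl refl

  identity-from-q-difference : ∀ y {Q P z₂ z₃ G H₀ H₁ H₂} →
    qi * Q ≈ P → qi * P ≈ z₂ → qi * z₂ ≈ z₃ →
    QDifference.Defect R a b c d q qi (qi * y) Q G H₀ H₁ ≈ 0# →
    H₀ ≈ (b + d - b * d * y * (a + c) * P) * H₁ + (P - 1#) * (b * d - a * c * z₂ * pow R (b * d * y) 2) * H₂ →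
    (1# - y * Q) * (1# - pow R y 2 * zpow R q qi -[1+ 1 ] * a * b * c * d) * H₀
    ≈
    (1# - pow R y 2 * z₂ * a * b * c * d) * (1# - y) * G
    - b * d * y * (1# - Q) * (1# - P) * (1# - a * b * c * d * pow R y 2 * z₂)
      * (1# - a * b * c * d * pow R y 2 * zpow R q qi -[1+ 1 ]) * H₂
    + (1# - Q)
      * ( y * (b + d + qi * b * d * (a + c))
        - pow R y 2 * ((qi * (1# + Q) * b * d * (a + c)) + zpow R q qi -[1+ 1 ] * (b + d) * a * b * c * d)
        + pow R y 4 * (z₃ * a * pow R b 2 * c * pow R d 2 * (a + c)))
      * H₁
  identity-from-q-difference y {Q} {P} {z₂} {z₃} {G} {H₀} {H₁} {H₂} qiQ≈P qiP≈z₂ qiz₂≈z₃ defect≈0 H₀-rec =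
    trans (solve 14 (λ a b c d qi y Q P z₂ z₃ G H₀ H₁ H₂ →
        let e  = a :* b :* c :* d
            t  = qi :* y
            κ  = e :* (b :+ d) :* t :* t :- b :* d :* (a :+ c) :* t
            y² = y :* (y :* :1)
            x  = b :* d :* y
            qi⁻² = qi :* (qi :* :1)
            β  = y :* (:1 :- Q) :* (:1 :- e :* t :* t)
            γ₁ = (:1 :- Q) :* b :* d :* (a :+ c) :* y :* y :* H₁ :- (:1 :- y) :* e :* qi :* y :* y :* G
            γ₂ = (:1 :- Q) :* e :* b :* d :* (a :+ c) :* qi :* y :* y :* y :* y :* H₁ :- (:1 :- y) :* e :* y :* y :* G
            γ₃ = (:1 :- Q) :* e :* b :* d :* (a :+ c) :* y :* y :* y :* y :* H₁
        in (:1 :- y :* Q) :* (:1 :- y² :* qi⁻² :* a :* b :* c :* d) :* H₀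
           := (:1 :- y² :* z₂ :* a :* b :* c :* d) :* (:1 :- y) :* G
              :- b :* d :* y :* (:1 :- Q) :* (:1 :- P) :* (:1 :- a :* b :* c :* d :* y² :* z₂)
                :* (:1 :- a :* b :* c :* d :* y² :* qi⁻²) :* H₂
              :+ (:1 :- Q)
                :* (y :* (b :+ d :+ qi :* b :* d :* (a :+ c))
                   :- y² :* ((qi :* (:1 :+ Q) :* b :* d :* (a :+ c)) :+ qi⁻² :* (b :+ d) :* a :* b :* c :* d)
                   :+ y :* (y :* (y :* (y :* :1))) :* (z₃ :* a :* (b :* (b :* :1)) :* c :* (d :* (d :* :1)) :* (a :+ c)))
                :* H₁
              :+ (β :* (H₀ :- ((b :+ d :- x :* (a :+ c) :* P) :* H₁ :+ (P :- :1) :* (b :* d :- a :* c :* z₂ :* (x :* (x :* :1))) :* H₂))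
                 :+ (y :- :1) :* ((:1 :- e :* Q :* t :* t) :* G :- (:1 :- e :* t :* t) :* H₀ :- (:1 :- Q) :* κ :* H₁)
                 :+ γ₁ :* (qi :* Q :- P) :+ γ₂ :* (qi :* P :- z₂) :+ γ₃ :* (qi :* z₂ :- z₃)))
        refl a b c d qi y Q P z₂ z₃ G H₀ H₁ H₂)
          (trans (+-congˡ corrections-vanish) (+-identityʳ _))
    where
    -- β and the γᵢ come from reducing LHS - RHS modulo the hypotheses.
    e β γ₁ γ₂ γ₃ corrections : Carrier
    e  = a * b * c * d
    β  = y * (1# - Q) * (1# - e * (qi * y) * (qi * y))
    γ₁ = (1# - Q) * b * d * (a + c) * y * y * H₁ - (1# - y) * e * qi * y * y * G
    γ₂ = (1# - Q) * e * b * d * (a + c) * qi * y * y * y * y * H₁ - (1# - y) * e * y * y * G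
    γ₃ = (1# - Q) * e * b * d * (a + c) * y * y * y * y * H₁

    corrections =
      β * (H₀ - ((b + d - b * d * y * (a + c) * P) * H₁ + (P - 1#) * (b * d - a * c * z₂ * pow R (b * d * y) 2) * H₂))
      + (y - 1#) * QDifference.Defect R a b c d q qi (qi * y) Q G H₀ H₁
      + γ₁ * (qi * Q - P) + γ₂ * (qi * P - z₂) + γ₃ * (qi * z₂ - z₃)

    corrections-vanish : corrections ≈ 0#
    corrections-vanish = trans
      (+-cong (+-cong (+-cong (+-cong (*-congˡ (x≈y⇒x∙y⁻¹≈ε H₀-rec)) (*-congˡ defect≈0))
        (*-congˡ (x≈y⇒x∙y⁻¹≈ε qiQ≈P))) (*-congˡ (x≈y⇒x∙y⁻¹≈ε qiP≈z₂))) (*-congˡ (x≈y⇒x∙y⁻¹≈ε qiz₂≈z₃)))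
      (solve 5 (λ u v w x z → u :* :0 :+ v :* :0 :+ w :* :0 :+ x :* :0 :+ z :* :0 := :0) refl β (y - 1#) γ₁ γ₂ γ₃)

proposition7p16 : {ℓ₁ ℓ₂ : Level} (R : CommutativeRing ℓ₁ ℓ₂) →
    let open CommutativeRing R in
    (a b c d q qi y : Carrier) → q * qi ≈ 1# → (m : ℕ) →
      (1# - y * pow R q m) * (1# - pow R y 2 * zpow R q qi -[1+ 1 ] * a * b * c * d)
        * F R a b c d q qi m (b * d * y)
      ≈
      (1# - pow R y 2 * zpow R q qi (+ m -ℤ + 2) * a * b * c * d) * (1# - y)
        * F R a b c d q qi m (b * d * y * qi)
      - b * d * y * (1# - pow R q m) * (1# - zpow R q qi (+ m -ℤ + 1))
        * (1# - a * b * c * d * pow R y 2 * zpow R q qi (+ m -ℤ + 2))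
        * (1# - a * b * c * d * pow R y 2 * zpow R q qi -[1+ 1 ])
        * Fz R a b c d q qi (+ m -ℤ + 2) (b * d * y)
      + (1# - pow R q m)
        * ( y * (b + d + qi * b * d * (a + c))
          - pow R y 2 * ((qi * (1# + pow R q m) * b * d * (a + c))
                         + zpow R q qi -[1+ 1 ] * (b + d) * a * b * c * d)
          + pow R y 4 * (zpow R q qi (+ m -ℤ + 3) * a * pow R b 2 * c * pow R d 2 * (a + c)))
        * Fz R a b c d q qi (+ m -ℤ + 1) (b * d * y)
proposition7p16 R a b c d q qi y q*qi≈1 zero = solve 6 (λ a b c d qi y →
    let y² = y :* (y :* :1)
        qi⁻² = qi :* (qi :* :1)
    in (:1 :- y :* :1) :* (:1 :- y² :* qi⁻² :* a :* b :* c :* d) :* :1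
       := (:1 :- y² :* qi⁻² :* a :* b :* c :* d) :* (:1 :- y) :* :1
          :- b :* d :* y :* (:1 :- :1) :* (:1 :- qi :* :1) :* (:1 :- a :* b :* c :* d :* y² :* qi⁻²)
            :* (:1 :- a :* b :* c :* d :* y² :* qi⁻²) :* :0
          :+ (:1 :- :1)
            :* (y :* (b :+ d :+ qi :* b :* d :* (a :+ c))
               :- y² :* ((qi :* (:1 :+ :1) :* b :* d :* (a :+ c)) :+ qi⁻² :* (b :+ d) :* a :* b :* c :* d)
               :+ y :* (y :* (y :* (y :* :1))) :* (qi :* (qi :* (qi :* :1)) :* a :* (b :* (b :* :1)) :* c :* (d :* (d :* :1)) :* (a :+ c)))
            :* :0)
  refl a b c d qi y
  where
  open CommutativeRing R
  open IntegerCoefficientSolver R using (solve; _:=_; _:+_; _:-_; _:*_; :0; :1)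
proposition7p16 R a b c d q qi y q*qi≈1 (suc n) =
  identity-from-q-difference R a b c d q qi y
    (zpow-pred R q qi q*qi≈1 (+ suc n)) qi*q^[m-1]≈q^[m-2] qi*q^[m-2]≈q^[m-3]
    q-difference-at-y/q (reflexive (F-rec R a b c d q qi n (b * d * y)))
  where
  open CommutativeRing R
  open QDifference R a b c d q qi (qi * y) using (Defect; Defect-congʳ)
  open IntegerCoefficientSolver R using (solve; _:=_; _:*_)

  qi*q^[m-1]≈q^[m-2] : qi * zpow R q qi (+ suc n -ℤ + 1) ≈ zpow R q qi (+ suc n -ℤ + 2)
  qi*q^[m-1]≈q^[m-2] = trans (zpow-pred R q qi q*qi≈1 (+ suc n -ℤ + 1))
                              (reflexive (≡.cong (zpow R q qi) (ℤₚ.+-assoc (+ suc n) ℤ.-1ℤ ℤ.-1ℤ)))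

  qi*q^[m-2]≈q^[m-3] : qi * zpow R q qi (+ suc n -ℤ + 2) ≈ zpow R q qi (+ suc n -ℤ + 3)
  qi*q^[m-2]≈q^[m-3] = trans (zpow-pred R q qi q*qi≈1 (+ suc n -ℤ + 2))
                              (reflexive (≡.cong (zpow R q qi) (ℤₚ.+-assoc (+ suc n) -[1+ 1 ] ℤ.-1ℤ)))

  bdt≈bdyqi : b * d * (qi * y) ≈ b * d * y * qi
  bdt≈bdyqi = solve 4 (λ b d qi y → b :* d :* (qi :* y) := b :* d :* y :* qi) refl b d qi y

  bdqt≈bdy : b * d * q * (qi * y) ≈ b * d * y
  bdqt≈bdy = trans (solve 5 (λ b d q qi y → b :* d :* q :* (qi :* y) := b :* d :* y :* (q :* qi)) refl b d q qi y)
                   (trans (*-congˡ q*qi≈1) (*-identityʳ _))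

  q-difference-at-y/q : Defect (pow R q (suc n)) (F R a b c d q qi (suc n) (b * d * y * qi))
                               (F R a b c d q qi (suc n) (b * d * y)) (F R a b c d q qi n (b * d * y))
                        ≈ 0#
  q-difference-at-y/q = trans (sym (Defect-congʳ (pow R q (suc n)) (F-cong R a b c d q qi (suc n) bdt≈bdyqi)
                                                                   (F-cong R a b c d q qi (suc n) bdqt≈bdy)
                                                                   (F-cong R a b c d q qi n bdqt≈bdy)))
                              (F-q-difference R a b c d q qi (qi * y) (suc n))
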